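{- Let $B=F(b_1,\ldots,b_n)$ be a Ferrers board with $0\le b_1\le\cdots\le b_n$ and $b_n>0$, and let $B^-=F(b_1,\ldots,b_{n-1})$. Then for all $1\le k\le n$, $$\mathbf{FT}_k(B,q)=q^{F_{b_n}}\mathbf{FT}_k(B^-,q)+[F_{b_n}]_q\,\mathbf{FT}_{k-1}(B^-,q)$$ and $$\overline{\mathbf{FT}}_k(B,q)=\overline{\mathbf{FT}}_k(B^-,q)+[F_{b_n}]_q\,\overline{\mathbf{FT}}_{k-1}(B^-,q).$$
   Context: Fibonacci numbers: $F_0=0$, $F_1=1$, $F_m=F_{m-1}+F_{m-2}$. For an integer $m$, $[m]_q=\frac{1-q^m}{1-q}$. For $m\ge1$, $\mathcal{F}_m$ is the set of tilings of a column of height $m$ (levels $1,\dots,m$ from the bottom) by tiles of heights 1 and 2 whose bottom-most tile has height 1; $\mathcal{F}_0=\emptyset$. For $T\in\mathcal{F}_m$, $\mathrm{rank}_m(T)=\sum F_{i-1}$, the sum over all $i$ such that $T$ has a tile of height 2 occupying levels $i-1$ and $i$. A Ferrers board $F(b_1,\dots,b_n)$ has columns $1,\dots,n$ of heights $b_1\le\cdots\le b_n$. For $0\le k\le n$, $\mathcal{FT}_k(B)$ is the set of Fibonacci file placements: a set $I$ of $k$ columns together with, for each $i\in I$, a tiling $T_i\in\mathcal{F}_{b_i}$ (for $k<0$ or $k>n$ the set is empty; for $k=0$ it contains only the empty placement). For such $P$, $w_{B,q}(P)=q^{\sum_{i\in I}\mathrm{rank}_{b_i}(T_i)+\sum_{j\notin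 I}F_{b_j}}$ and $\overline{w}_{B,q}(P)=q^{\sum_{i\in I}\mathrm{rank}_{b_i}(T_i)}$. Then $\mathbf{FT}_k(B,q)=\sum_{P\in\mathcal{FT}_k(B)}w_{B,q}(P)$ and $\overline{\mathbf{FT}}_k(B,q)=\sum_{P\in\mathcal{FT}_k(B)}\overline{w}_{B,q}(P)$. -}

module Defs where

open import Data.Nat using (ℕ; zero; suc; _+_; _≟_)
open import Data.List using (List; []; _∷_; [_]; map; _++_; concatMap; filter; foldr)
open import Data.Maybe using (Maybe; just; nothing)
open import Algebra.Bundles using (CommutativeSemiring)

fib : ℕ → ℕ
fib zero = zero
fib (suc zero) = suc zero
fib (suc (suc n)) = fib (suc n) + fib n

-- A tile of height 1 or 2; a tiling of a column is the list of its tiles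
-- read from the bottom (level 1) upwards.
data Tile : Set where
  one two : Tile

Tiling : Set
Tiling = List Tile

tilingsOf : ℕ → List Tiling
tilingsOf zero = [ [] ]
tilingsOf (suc zero) = [ one ∷ [] ]
tilingsOf (suc (suc m)) = map (one ∷_) (tilingsOf (suc m)) ++ map (two ∷_) (tilingsOf m)

fibTilings : ℕ → List Tiling
fibTilings zero = []
fibTilings (suc m) = map (one ∷_) (tilingsOf m)

-- rankFrom l T : the next tile of T starts at level l.  A height-2 tile
-- occupying levels l = i-1 and l+1 = i contributes F_{i-1} = F_l.
rankFrom : ℕ → Tiling → ℕ
rankFrom l [] = zero
rankFrom l (one ∷ t) = rankFrom (suc l) t
rankFrom l (two ∷ t) = fib l + rankFrom (suc (suc l)) t

rank : Tiling → ℕ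
rank t = rankFrom 1 t

-- A placement on a board with columns b_1..b_n: for each column j (in order)
-- either nothing (j ∉ I) or a tiling T_j ∈ 𝓕_{b_j} (j ∈ I).
Placement : Set
Placement = List (Maybe Tiling)

allPlacements : List ℕ → List Placement
allPlacements [] = [ [] ]
allPlacements (b ∷ bs) =
  concatMap (λ c → map (c ∷_) (allPlacements bs)) (nothing ∷ map just (fibTilings b))

numPlaced : Placement → ℕ
numPlaced [] = zero
numPlaced (nothing ∷ p) = numPlaced p
numPlaced (just _ ∷ p) = suc (numPlaced p)

placements : List ℕ → ℕ → List Placement
placements bs k = filter (λ p → numPlaced p ≟ k) (allPlacements bs)

wExp : List ℕ → Placement → ℕ
wExp (b ∷ bs) (nothing ∷ p) = fib b + wExp bs p
wExp (b ∷ bs) (just t ∷ p) = rank t + wExp bs p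
wExp _ _ = zero

wbarExp : List ℕ → Placement → ℕ
wbarExp (b ∷ bs) (nothing ∷ p) = wbarExp bs p
wbarExp (b ∷ bs) (just t ∷ p) = rank t + wbarExp bs p
wbarExp _ _ = zero

module _ {c ℓ} (R : CommutativeSemiring c ℓ) where
  open CommutativeSemiring R using (Carrier; 1#; 0#) renaming (_+_ to _⊕_; _*_ to _⊛_)

  pow : Carrier → ℕ → Carrier
  pow q zero = 1#
  pow q (suc n) = q ⊛ pow q n

  sumR : List Carrier → Carrier
  sumR = foldr _⊕_ 0#

  qint : ℕ → Carrier → Carrier
  qint zero q = 0#
  qint (suc m) q = 1# ⊕ (q ⊛ qint m q)

  FT : List ℕ → ℕ → Carrier → Carrier
  FT bs k q = sumR (map (λ p → pow q (wExp bs p)) (placements bs k))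

  FTbar : List ℕ → ℕ → Carrier → Carrier
  FTbar bs k q = sumR (map (λ p → pow q (wbarExp bs p)) (placements bs k))

-- Each column contributes independently: empty with weight q^{e b} (e b = F_b for w,
-- e b = 0 for w̄), or filled by some T ∈ 𝓕_b with weight q^{rank T}.  So Σ_k FT_k x^k is
-- the product over the columns of (q^{e b} + S_b x), where S_b = Σ_{T ∈ 𝓕_b} q^{rank T}.
-- Splitting off the top tile gives S_{m+2} = S_{m+1} + q^{F_{m+1}} S_m, the recursion
-- of [F_{m+2}]_q = [F_{m+1}]_q + q^{F_{m+1}} [F_m]_q, hence S_b = [F_b]_q.  Appending the
-- last column multiplies by its factor, and since the factors commute this follows from
-- the recursion for the first column, which is read off the definition of placements.
module Submission where

open import Defs
open import Data.Nat using (ℕ; zero; suc; _≤_; _<_; _∸_; _≡ᵇ_; _≟_)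
open import Data.Bool using (true; false; if_then_else_)
import Data.Nat as ℕ
import Data.Nat.Properties as ℕₚ
open import Data.List using (List; _∷_; []; _++_; length; map; filter; concatMap)
open import Data.List.Relation.Unary.All as All using (All; []; _∷_)
open import Data.List.Relation.Unary.All.Properties using (++⁺; map⁺)
open import Data.List.Relation.Unary.Linked using (Linked)
open import Data.Maybe using (just; nothing)
open import Data.Product using (_×_; _,_)
open import Function using (_∘_; const)
open import Relation.Binary.PropositionalEquality as ≡ using (_≡_; _≗_)
open import Algebra.Bundles using (CommutativeSemiring)

-- An empty column of height b contributes e b: e = fib gives w, e = const 0 gives w̄.
placementExp : (ℕ → ℕ) → List ℕ → Placement → ℕ
placementExp e (b ∷ bs) (nothing ∷ p) = e b ℕ.+ placementExp e bs p
placementExp e (b ∷ bs) (just t ∷ p) = rank t ℕ.+ placementExp e bs p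
placementExp e _ _ = zero

wExp≗placementExp-fib : ∀ bs → wExp bs ≗ placementExp fib bs
wExp≗placementExp-fib [] p = ≡.refl
wExp≗placementExp-fib (b ∷ bs) [] = ≡.refl
wExp≗placementExp-fib (b ∷ bs) (nothing ∷ p) = ≡.cong (fib b ℕ.+_) (wExp≗placementExp-fib bs p)
wExp≗placementExp-fib (b ∷ bs) (just t ∷ p) = ≡.cong (rank t ℕ.+_) (wExp≗placementExp-fib bs p)

wbarExp≗placementExp-0 : ∀ bs → wbarExp bs ≗ placementExp (const 0) bs
wbarExp≗placementExp-0 [] p = ≡.refl
wbarExp≗placementExp-0 (b ∷ bs) [] = ≡.refl
wbarExp≗placementExp-0 (b ∷ bs) (nothing ∷ p) = wbarExp≗placementExp-0 bs p
wbarExp≗placementExp-0 (b ∷ bs) (just t ∷ p) = ≡.cong (rank t ℕ.+_) (wbarExp≗placementExp-0 bs p)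

height : Tiling → ℕ
height [] = zero
height (one ∷ t) = suc (height t)
height (two ∷ t) = suc (suc (height t))

tilingsOf-height : ∀ m → All (λ t → height t ≡ m) (tilingsOf m)
tilingsOf-height zero = ≡.refl ∷ []
tilingsOf-height (suc zero) = ≡.refl ∷ []
tilingsOf-height (suc (suc m)) =
  ++⁺ (map⁺ (All.map (≡.cong suc) (tilingsOf-height (suc m))))
      (map⁺ (All.map (≡.cong (suc ∘ suc)) (tilingsOf-height m)))

rankFrom-++-one : ∀ l t → rankFrom l (t ++ one ∷ []) ≡ rankFrom l t
rankFrom-++-one l [] = ≡.refl
rankFrom-++-one l (one ∷ t) = rankFrom-++-one (suc l) t
rankFrom-++-one l (two ∷ t) = ≡.cong (fib l ℕ.+_) (rankFrom-++-one (suc (suc l)) t)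

rankFrom-++-two : ∀ l t → rankFrom l (t ++ two ∷ []) ≡ rankFrom l t ℕ.+ fib (l ℕ.+ height t)
rankFrom-++-two l [] rewrite ℕₚ.+-identityʳ l = ℕₚ.+-identityʳ (fib l)
rankFrom-++-two l (one ∷ t) rewrite ℕₚ.+-suc l (height t) = rankFrom-++-two (suc l) t
rankFrom-++-two l (two ∷ t) rewrite ℕₚ.+-suc l (suc (height t)) | ℕₚ.+-suc l (height t) =
  ≡.trans (≡.cong (fib l ℕ.+_) (rankFrom-++-two (suc (suc l)) t)) (≡.sym (ℕₚ.+-assoc (fib l) _ _))

module _ {c ℓ} (R : CommutativeSemiring c ℓ) where
  open CommutativeSemiring R hiding (zero)
  open import Relation.Binary.Reasoning.Setoid setoid
  open import Algebra.Properties.CommutativeSemigroup +-commutativeSemigroup using (interchange)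
  open import Algebra.Solver.Ring.NaturalCoefficients.Default R

  Σ : ∀ {A : Set} → (A → Carrier) → List A → Carrier
  Σ f xs = sumR R (map f xs)

  Σ-++ : ∀ {A : Set} (f : A → Carrier) xs ys → Σ f (xs ++ ys) ≈ Σ f xs + Σ f ys
  Σ-++ f [] ys = sym (+-identityˡ _)
  Σ-++ f (x ∷ xs) ys = trans (+-congˡ (Σ-++ f xs ys)) (sym (+-assoc _ _ _))

  Σ-map : ∀ {A B : Set} (f : B → Carrier) (g : A → B) xs → Σ f (map g xs) ≡ Σ (f ∘ g) xs
  Σ-map f g [] = ≡.refl
  Σ-map f g (x ∷ xs) = ≡.cong (f (g x) +_) (Σ-map f g xs)

  Σ-concatMap : ∀ {A B : Set} (f : B → Carrier) (g : A → List B) xs →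
    Σ f (concatMap g xs) ≈ Σ (Σ f ∘ g) xs
  Σ-concatMap f g [] = refl
  Σ-concatMap f g (x ∷ xs) = trans (Σ-++ f (g x) (concatMap g xs)) (+-congˡ (Σ-concatMap f g xs))

  Σ-congᴬˡˡ : ∀ {A : Set} {P : A → Set} {f g : A → Carrier} →
    (∀ {x} → P x → f x ≈ g x) → ∀ {xs} → All P xs → Σ f xs ≈ Σ g xs
  Σ-congᴬˡˡ f≈g [] = refl
  Σ-congᴬˡˡ f≈g (px ∷ pxs) = +-cong (f≈g px) (Σ-congᴬˡˡ f≈g pxs)

  Σ-cong : ∀ {A : Set} {f g : A → Carrier} → (∀ x → f x ≈ g x) → ∀ xs → Σ f xs ≈ Σ g xs
  Σ-cong f≈g [] = refl
  Σ-cong f≈g (x ∷ xs) = +-cong (f≈g x) (Σ-cong f≈g xs)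

  *-distribˡ-Σ : ∀ {A : Set} a (f : A → Carrier) xs → a * Σ f xs ≈ Σ (λ x → a * f x) xs
  *-distribˡ-Σ a f [] = zeroʳ a
  *-distribˡ-Σ a f (x ∷ xs) = trans (distribˡ a _ _) (+-congˡ (*-distribˡ-Σ a f xs))

  *-distribʳ-Σ : ∀ {A : Set} a (f : A → Carrier) xs → Σ f xs * a ≈ Σ (λ x → f x * a) xs
  *-distribʳ-Σ a f xs =
    trans (*-comm _ a) (trans (*-distribˡ-Σ a f xs) (Σ-cong (λ x → *-comm a (f x)) xs))

  Σ-0# : ∀ {A : Set} (xs : List A) → Σ (const 0#) xs ≈ 0#
  Σ-0# [] = refl
  Σ-0# (x ∷ xs) = trans (+-identityˡ _) (Σ-0# xs)

  δ : ℕ → ℕ → Carrier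
  δ m n = if m ≡ᵇ n then 1# else 0#

  Σ-filter : ∀ {A : Set} (f : A → Carrier) (n : A → ℕ) k xs →
    Σ f (filter (λ x → n x ≟ k) xs) ≈ Σ (λ x → δ (n x) k * f x) xs
  Σ-filter f n k [] = refl
  Σ-filter f n k (x ∷ xs) with n x ≡ᵇ k
  ... | true = +-cong (sym (*-identityˡ _)) (Σ-filter f n k xs)
  ... | false = trans (Σ-filter f n k xs) (sym (trans (+-congʳ (zeroˡ _)) (+-identityˡ _)))

  pow-homo-* : ∀ q m n → pow R q (m ℕ.+ n) ≈ pow R q m * pow R q n
  pow-homo-* q zero n = sym (*-identityˡ _)
  pow-homo-* q (suc m) n = trans (*-congˡ (pow-homo-* q m n)) (sym (*-assoc _ _ _))

  qint-+ : ∀ m n q → qint R (m ℕ.+ n) q ≈ qint R m q + pow R q m * qint R n q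
  qint-+ zero n q = sym (trans (+-identityˡ _) (*-identityˡ _))
  qint-+ (suc m) n q = trans (+-congˡ (*-congˡ (qint-+ m n q)))
    (solve 5 (λ o x y p z → o :+ x :* (y :+ p :* z) := (o :+ x :* y) :+ (x :* p) :* z)
      refl 1# q (qint R m q) (pow R q m) (qint R n q))

  Σ-tilingsOf-cons : ∀ m (f : Tiling → Carrier) →
    Σ f (tilingsOf (suc (suc m))) ≈ Σ (f ∘ (one ∷_)) (tilingsOf (suc m)) + Σ (f ∘ (two ∷_)) (tilingsOf m)
  Σ-tilingsOf-cons m f = trans (Σ-++ f (map (one ∷_) (tilingsOf (suc m))) (map (two ∷_) (tilingsOf m)))
    (+-cong (reflexive (Σ-map f (one ∷_) (tilingsOf (suc m)))) (reflexive (Σ-map f (two ∷_) (tilingsOf m))))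

  -- Splitting off the top tile rather than the bottom one, since only the top tile's
  -- contribution to the rank depends on the height.
  Σ-tilingsOf-snoc : ∀ m (f : Tiling → Carrier) →
    Σ f (tilingsOf (suc (suc m))) ≈ Σ (f ∘ (_++ one ∷ [])) (tilingsOf (suc m)) + Σ (f ∘ (_++ two ∷ [])) (tilingsOf m)
  Σ-tilingsOf-snoc zero f =
    solve 2 (λ a b → a :+ (b :+ con 0) := (a :+ con 0) :+ (b :+ con 0)) refl
      (f (one ∷ one ∷ [])) (f (two ∷ []))
  Σ-tilingsOf-snoc (suc zero) f =
    solve 3 (λ a b c → a :+ (b :+ (c :+ con 0)) := (a :+ (c :+ con 0)) :+ (b :+ con 0)) refl
      (f (one ∷ one ∷ one ∷ [])) (f (one ∷ two ∷ [])) (f (two ∷ one ∷ []))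
  Σ-tilingsOf-snoc (suc (suc m)) f = begin
    Σ f (tilingsOf (4 ℕ.+ m))
      ≈⟨ Σ-tilingsOf-cons (suc (suc m)) f ⟩
    Σ (f ∘ (one ∷_)) (tilingsOf (3 ℕ.+ m)) + Σ (f ∘ (two ∷_)) (tilingsOf (2 ℕ.+ m))
      ≈⟨ +-cong (Σ-tilingsOf-snoc (suc m) (f ∘ (one ∷_))) (Σ-tilingsOf-snoc m (f ∘ (two ∷_))) ⟩
    (Σ (g₁ ∘ (one ∷_)) (tilingsOf (2 ℕ.+ m)) + Σ (g₂ ∘ (one ∷_)) (tilingsOf (suc m)))
      + (Σ (g₁ ∘ (two ∷_)) (tilingsOf (suc m)) + Σ (g₂ ∘ (two ∷_)) (tilingsOf m))
      ≈⟨ interchange _ _ _ _ ⟩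
    (Σ (g₁ ∘ (one ∷_)) (tilingsOf (2 ℕ.+ m)) + Σ (g₁ ∘ (two ∷_)) (tilingsOf (suc m)))
      + (Σ (g₂ ∘ (one ∷_)) (tilingsOf (suc m)) + Σ (g₂ ∘ (two ∷_)) (tilingsOf m))
      ≈⟨ sym (+-cong (Σ-tilingsOf-cons (suc m) g₁) (Σ-tilingsOf-cons m g₂)) ⟩
    Σ g₁ (tilingsOf (3 ℕ.+ m)) + Σ g₂ (tilingsOf (2 ℕ.+ m)) ∎
    where
    g₁ g₂ : Tiling → Carrier
    g₁ = f ∘ (_++ one ∷ [])
    g₂ = f ∘ (_++ two ∷ [])

  Σ-tilingsOf-rankFrom-2 : ∀ m q → Σ (pow R q ∘ rankFrom 2) (tilingsOf m) ≈ qint R (fib (suc m)) q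
  Σ-tilingsOf-rankFrom-2 zero q = +-congˡ (sym (zeroʳ q))
  Σ-tilingsOf-rankFrom-2 (suc zero) q = +-congˡ (sym (zeroʳ q))
  Σ-tilingsOf-rankFrom-2 (suc (suc m)) q = begin
    Σ f (tilingsOf (suc (suc m)))
      ≈⟨ Σ-tilingsOf-snoc m f ⟩
    Σ (f ∘ (_++ one ∷ [])) (tilingsOf (suc m)) + Σ (f ∘ (_++ two ∷ [])) (tilingsOf m)
      ≈⟨ +-cong (Σ-cong (λ t → reflexive (≡.cong (pow R q) (rankFrom-++-one 2 t))) (tilingsOf (suc m)))
                (Σ-congᴬˡˡ top-two (tilingsOf-height m)) ⟩
    Σ f (tilingsOf (suc m)) + Σ (λ t → f t * pow R q (fib (2 ℕ.+ m))) (tilingsOf m)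
      ≈⟨ +-cong (Σ-tilingsOf-rankFrom-2 (suc m) q)
                (trans (sym (*-distribʳ-Σ _ f (tilingsOf m))) (*-congʳ (Σ-tilingsOf-rankFrom-2 m q))) ⟩
    qint R (fib (2 ℕ.+ m)) q + qint R (fib (suc m)) q * pow R q (fib (2 ℕ.+ m))
      ≈⟨ +-congˡ (*-comm _ _) ⟩
    qint R (fib (2 ℕ.+ m)) q + pow R q (fib (2 ℕ.+ m)) * qint R (fib (suc m)) q
      ≈⟨ sym (qint-+ (fib (2 ℕ.+ m)) (fib (suc m)) q) ⟩
    qint R (fib (3 ℕ.+ m)) q ∎
    where
    f : Tiling → Carrier
    f = pow R q ∘ rankFrom 2
    top-two : ∀ {t} → height t ≡ m → f (t ++ two ∷ []) ≈ f t * pow R q (fib (2 ℕ.+ m))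
    top-two {t} ≡.refl = trans (reflexive (≡.cong (pow R q) (rankFrom-++-two 2 t))) (pow-homo-* q (rankFrom 2 t) _)

  columnSum : ℕ → Carrier → Carrier
  columnSum b q = Σ (pow R q ∘ rank) (fibTilings b)

  columnSum≈qint-fib : ∀ b q → columnSum b q ≈ qint R (fib b) q
  columnSum≈qint-fib zero q = refl
  columnSum≈qint-fib (suc m) q =
    trans (reflexive (Σ-map (pow R q ∘ rank) (one ∷_) (tilingsOf m))) (Σ-tilingsOf-rankFrom-2 m q)

  -- The coefficients of (a + C x) · Σₖ g k xᵏ.
  timesLinear : Carrier → Carrier → (ℕ → Carrier) → ℕ → Carrier
  timesLinear a C g zero = a * g zero
  timesLinear a C g (suc k) = a * g (suc k) + C * g k

  timesLinear-cong : ∀ a C {g h : ℕ → Carrier} → (∀ k → g k ≈ h k) →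
    ∀ k → timesLinear a C g k ≈ timesLinear a C h k
  timesLinear-cong a C g≈h zero = *-congˡ (g≈h zero)
  timesLinear-cong a C g≈h (suc k) = +-cong (*-congˡ (g≈h (suc k))) (*-congˡ (g≈h k))

  timesLinear-comm : ∀ a C a′ C′ g k →
    timesLinear a C (timesLinear a′ C′ g) k ≈ timesLinear a′ C′ (timesLinear a C g) k
  timesLinear-comm a C a′ C′ g zero =
    solve 3 (λ a a′ x → a :* (a′ :* x) := a′ :* (a :* x)) refl a a′ (g 0)
  timesLinear-comm a C a′ C′ g (suc zero) =
    solve 6 (λ a C a′ C′ x y → a :* (a′ :* x :+ C′ :* y) :+ C :* (a′ :* y)
                             := a′ :* (a :* x :+ C :* y) :+ C′ :* (a :* y))
      refl a C a′ C′ (g 1) (g 0)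
  timesLinear-comm a C a′ C′ g (suc (suc k)) =
    solve 7 (λ a C a′ C′ x y z → a :* (a′ :* x :+ C′ :* y) :+ C :* (a′ :* y :+ C′ :* z)
                               := a′ :* (a :* x :+ C :* y) :+ C′ :* (a :* y :+ C :* z))
      refl a C a′ C′ (g (2 ℕ.+ k)) (g (suc k)) (g k)

  weight : (ℕ → ℕ) → List ℕ → ℕ → Carrier → Placement → Carrier
  weight e bs k q p = δ (numPlaced p) k * pow R q (placementExp e bs p)

  placementSum : (ℕ → ℕ) → List ℕ → ℕ → Carrier → Carrier
  placementSum e bs k q = Σ (weight e bs k q) (allPlacements bs)

  δ-*-pow-+ : ∀ d q m n → d * pow R q (m ℕ.+ n) ≈ pow R q m * (d * pow R q n)
  δ-*-pow-+ d q m n = trans (*-congˡ (pow-homo-* q m n))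
    (solve 3 (λ d x y → d :* (x :* y) := x :* (d :* y)) refl d (pow R q m) (pow R q n))

  placementSum-cons : ∀ e b bs q k → placementSum e (b ∷ bs) k q ≈
    timesLinear (pow R q (e b)) (columnSum b q) (λ j → placementSum e bs j q) k
  placementSum-cons e b bs q k = begin
    placementSum e (b ∷ bs) k q
      ≈⟨ Σ-concatMap (weight e (b ∷ bs) k q) (λ x → map (x ∷_) ps) (nothing ∷ map just (fibTilings b)) ⟩
    Σ (λ x → Σ (weight e (b ∷ bs) k q) (map (x ∷_) ps)) (nothing ∷ map just (fibTilings b))
      ≈⟨ reflexive (≡.cong₂ _+_ (Σ-map _ (nothing ∷_) ps) (Σ-map _ just (fibTilings b))) ⟩
    Σ (weight e (b ∷ bs) k q ∘ (nothing ∷_)) ps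
      + Σ (λ t → Σ (weight e (b ∷ bs) k q) (map (just t ∷_) ps)) (fibTilings b)
      ≈⟨ +-cong empty (Σ-cong (λ t → reflexive (Σ-map _ (just t ∷_) ps)) (fibTilings b)) ⟩
    pow R q (e b) * placementSum e bs k q
      + Σ (λ t → Σ (weight e (b ∷ bs) k q ∘ (just t ∷_)) ps) (fibTilings b)
      ≈⟨ filled k ⟩
    timesLinear (pow R q (e b)) (columnSum b q) (λ j → placementSum e bs j q) k ∎
    where
    ps = allPlacements bs

    empty : Σ (weight e (b ∷ bs) k q ∘ (nothing ∷_)) ps ≈ pow R q (e b) * placementSum e bs k q
    empty = trans (Σ-cong (λ p → δ-*-pow-+ _ q (e b) _) ps) (sym (*-distribˡ-Σ _ _ ps))

    filled : ∀ k → pow R q (e b) * placementSum e bs k q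
      + Σ (λ t → Σ (weight e (b ∷ bs) k q ∘ (just t ∷_)) ps) (fibTilings b)
      ≈ timesLinear (pow R q (e b)) (columnSum b q) (λ j → placementSum e bs j q) k
    filled zero = trans (+-congˡ (trans (Σ-cong no-column ps′) (Σ-0# ps′))) (+-identityʳ _)
      where
      ps′ = fibTilings b
      no-column : ∀ t → Σ (weight e (b ∷ bs) 0 q ∘ (just t ∷_)) ps ≈ 0#
      no-column t = trans (Σ-cong (λ p → zeroˡ _) ps) (Σ-0# ps)
    filled (suc k) = +-congˡ (begin
      Σ (λ t → Σ (weight e (b ∷ bs) (suc k) q ∘ (just t ∷_)) ps) (fibTilings b)
        ≈⟨ Σ-cong (λ t → trans (Σ-cong (λ p → δ-*-pow-+ _ q (rank t) _) ps) (sym (*-distribˡ-Σ _ _ ps))) (fibTilings b) ⟩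
      Σ (λ t → pow R q (rank t) * placementSum e bs k q) (fibTilings b)
        ≈⟨ sym (*-distribʳ-Σ _ (pow R q ∘ rank) (fibTilings b)) ⟩
      columnSum b q * placementSum e bs k q ∎)

  placementSum-snoc : ∀ e bs b q k → placementSum e (bs ++ b ∷ []) k q ≈
    timesLinear (pow R q (e b)) (columnSum b q) (λ j → placementSum e bs j q) k
  placementSum-snoc e [] b q k = placementSum-cons e b [] q k
  placementSum-snoc e (c ∷ bs) b q k = begin
    placementSum e (c ∷ bs ++ b ∷ []) k q
      ≈⟨ placementSum-cons e c (bs ++ b ∷ []) q k ⟩
    timesLinear a C (λ j → placementSum e (bs ++ b ∷ []) j q) k
      ≈⟨ timesLinear-cong a C (placementSum-snoc e bs b q) k ⟩
    timesLinear a C (timesLinear a′ C′ (λ j → placementSum e bs j q)) k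
      ≈⟨ timesLinear-comm a C a′ C′ _ k ⟩
    timesLinear a′ C′ (timesLinear a C (λ j → placementSum e bs j q)) k
      ≈⟨ timesLinear-cong a′ C′ (λ j → sym (placementSum-cons e c bs q j)) k ⟩
    timesLinear a′ C′ (λ j → placementSum e (c ∷ bs) j q) k ∎
    where
    a = pow R q (e c)
    C = columnSum c q
    a′ = pow R q (e b)
    C′ = columnSum b q

  placements-sum : ∀ e bs k q {w : Placement → ℕ} → w ≗ placementExp e bs →
    Σ (pow R q ∘ w) (placements bs k) ≈ placementSum e bs k q
  placements-sum e bs k q w≗ = trans (Σ-filter _ numPlaced k (allPlacements bs))
    (Σ-cong (λ p → *-congˡ (reflexive (≡.cong (pow R q) (w≗ p)))) (allPlacements bs))

  FT-snoc : ∀ bs b k q → FT R (bs ++ b ∷ []) (suc k) q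
    ≈ pow R q (fib b) * FT R bs (suc k) q + qint R (fib b) q * FT R bs k q
  FT-snoc bs b k q = begin
    FT R (bs ++ b ∷ []) (suc k) q
      ≈⟨ placements-sum fib (bs ++ b ∷ []) (suc k) q (wExp≗placementExp-fib (bs ++ b ∷ [])) ⟩
    placementSum fib (bs ++ b ∷ []) (suc k) q
      ≈⟨ placementSum-snoc fib bs b q (suc k) ⟩
    pow R q (fib b) * placementSum fib bs (suc k) q + columnSum b q * placementSum fib bs k q
      ≈⟨ +-cong (*-congˡ (sym (FT≈ (suc k)))) (*-cong (columnSum≈qint-fib b q) (sym (FT≈ k))) ⟩
    pow R q (fib b) * FT R bs (suc k) q + qint R (fib b) q * FT R bs k q ∎
    where
    FT≈ : ∀ j → FT R bs j q ≈ placementSum fib bs j q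
    FT≈ j = placements-sum fib bs j q (wExp≗placementExp-fib bs)

  FTbar-snoc : ∀ bs b k q → FTbar R (bs ++ b ∷ []) (suc k) q
    ≈ FTbar R bs (suc k) q + qint R (fib b) q * FTbar R bs k q
  FTbar-snoc bs b k q = begin
    FTbar R (bs ++ b ∷ []) (suc k) q
      ≈⟨ placements-sum (const 0) (bs ++ b ∷ []) (suc k) q (wbarExp≗placementExp-0 (bs ++ b ∷ [])) ⟩
    placementSum (const 0) (bs ++ b ∷ []) (suc k) q
      ≈⟨ placementSum-snoc (const 0) bs b q (suc k) ⟩
    1# * placementSum (const 0) bs (suc k) q + columnSum b q * placementSum (const 0) bs k q
      ≈⟨ +-cong (trans (*-identityˡ _) (sym (FTbar≈ (suc k)))) (*-cong (columnSum≈qint-fib b q) (sym (FTbar≈ k))) ⟩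
    FTbar R bs (suc k) q + qint R (fib b) q * FTbar R bs k q ∎
    where
    FTbar≈ : ∀ j → FTbar R bs j q ≈ placementSum (const 0) bs j q
    FTbar≈ j = placements-sum (const 0) bs j q (wbarExp≗placementExp-0 bs)

theorem3 : ∀ {c ℓ} (R : CommutativeSemiring c ℓ) (bs : List ℕ) (b : ℕ)
    → Linked _≤_ (bs ++ b ∷ [])
    → 0 < b
    → (k : ℕ) → 1 ≤ k → k ≤ length (bs ++ b ∷ [])
    → (q : CommutativeSemiring.Carrier R)
    → let open CommutativeSemiring R in
    (FT R (bs ++ b ∷ []) k q
    ≈ pow R q (fib b) * FT R bs k q + qint R (fib b) q * FT R bs (k ∸ 1) q)
    × (FTbar R (bs ++ b ∷ []) k q
    ≈ FTbar R bs k q + qint R (fib b) q * FTbar R bs (k ∸ 1) q)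
theorem3 R bs b _ _ (suc k) _ _ q = FT-snoc R bs b k q , FTbar-snoc R bs b k q
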